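{- Let $m\ge1$ and let $\epsilon=(\epsilon_1,\dots,\epsilon_s)$ be a circular sequence of level $\lambda_\epsilon\ge0$ with $\epsilon_i\in\{1,0,-1\}$ for all $i$. Then $c(\Gamma^m_\epsilon)=\max\{0,m-\lambda_\epsilon\}$.
   Context: Indices are mod $s$. $\epsilon$ is a circular sequence of level $\lambda\ge0$ if $\sum_{j=1}^s\epsilon_j=0$, $|\sum_{j=a}^b\epsilon_j|\le\lambda$ for all $1\le a\le s$, $a\le b\le a+s-1$, with equality for some such $a,b$. Digraph $\Gamma^m_\epsilon$: vertices $x_{i,t}$, $0\le i\le m-1$, $t\in\{1,\dots,s\}$, some "marked zero". If $s=1$: if $\epsilon_1\ne0$ all vertices are marked zero and there are no edges; if $\epsilon_1=0$ nothing is marked and each $x_{i,1}$ carries a loop of weight $0$. If $s\ge2$: for each $t$ let $A_t=\max(\epsilon_t,0)$, $B_t=\max(-\epsilon_{t+1},0)$; for each $j\in\{0,\dots,m-1\}$: if $j\ge\max(A_t,B_t)$ add an edge from $x_{j-A_t,t}$ to $x_{j-B_t,t+1}$ of weight $A_t-B_t$; if $A_t\le j<B_t$ mark $x_{j-A_t,t}$ zero; if $B_t\le j<A_t$ mark $x_{j-B_t,t+1}$ zero. Each connected component is a directed path or a directed cycle; $c(\Gamma^m_\epsilon)$ is the number of components that are directed cycles (circular digraphs). -}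

module Defs where

open import Data.Nat as ℕ using (ℕ; zero; suc; _∸_; _⊔_; NonZero; _≤?_; _≟_)
open import Data.Nat.Properties using (m∸n≤m; ≤-<-trans)
open import Data.Nat.DivMod using (_mod_)
open import Data.Integer as ℤ using (ℤ; +_; -[1+_]; ∣_∣)
open import Data.Fin as F using (Fin; toℕ; fromℕ<)
open import Data.Fin.Properties using (toℕ<n)
import Data.Fin.Properties as FP
open import Data.Product using (Σ; ∃; _×_; _,_; proj₁; proj₂)
open import Data.Product.Properties using (≡-dec)
open import Data.List using (List; []; _∷_; _++_; [_]; zip; allFin; concatMap; map; length)
open import Data.List.Membership.Propositional using (_∈_)
open import Data.List.Relation.Unary.Unique.Propositional using (Unique)
open import Relation.Nullary using (yes; no; ¬_)
open import Relation.Binary.PropositionalEquality using (_≡_)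
open import Relation.Binary.Construct.Closure.Symmetric using (SymClosure)
open import Relation.Binary.Construct.Closure.ReflexiveTransitive using (Star)
open import Function.Bundles using (_⇔_)

-- Integer sequences indexed by Fin s (positions 1..s of the paper are
-- positions 0..s-1 here); indices are taken mod s.

pos : ℤ → ℕ
pos (+ n)      = n
pos -[1+ n ]   = 0

sumℤ : List ℤ → ℤ
sumℤ []       = + 0
sumℤ (x ∷ xs) = x ℤ.+ sumℤ xs

module _ (s : ℕ) .{{_ : NonZero s}} where

  at : (Fin s → ℤ) → ℕ → ℤ
  at ε k = ε (k mod s)

  circSum : (Fin s → ℤ) → Fin s → ℕ → ℤ
  circSum ε a zero    = + 0
  circSum ε a (suc ℓ) = at ε (toℕ a ℕ.+ ℓ) ℤ.+ circSum ε a ℓ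

  totalSum : (Fin s → ℤ) → ℤ
  totalSum ε = sumℤ (map ε (allFin s))

  -- ε is a circular sequence of level λ:
  --   sum ε = 0, every circular block sum (a ≤ b ≤ a+s-1, i.e. block
  --   length ℓ = b-a+1 with 1 ≤ ℓ ≤ s) has |sum| ≤ λ, with equality for some block.
  IsCircularOfLevel : (Fin s → ℤ) → ℕ → Set
  IsCircularOfLevel ε lv =
    totalSum ε ≡ + 0
    × (∀ (a : Fin s) (ℓ : ℕ) → 1 ℕ.≤ ℓ → ℓ ℕ.≤ s → ∣ circSum ε a ℓ ∣ ℕ.≤ lv)
    × (∃ λ (a : Fin s) → ∃ λ (ℓ : ℕ) → 1 ℕ.≤ ℓ × ℓ ℕ.≤ s × ∣ circSum ε a ℓ ∣ ≡ lv)

  -- The digraph Γ^m_ε.  Vertex x_{i,t} is (i , t) : Fin m × Fin s.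

  Vertex : ℕ → Set
  Vertex m = Fin m × Fin s

  record Edge (m : ℕ) : Set where
    constructor edge
    field
      src    : Vertex m
      tgt    : Vertex m
      weight : ℤ
  open Edge public

  next : Fin s → Fin s
  next t = suc (toℕ t) mod s

  minus : ∀ {m} → Fin m → ℕ → Fin m
  minus j k = fromℕ< (≤-<-trans (m∸n≤m (toℕ j) k) (toℕ<n j))

  A : (Fin s → ℤ) → Fin s → ℕ
  A ε t = pos (ε t)

  B : (Fin s → ℤ) → Fin s → ℕ
  B ε t = pos (ℤ.- ε (next t))

  edgeAt : ∀ m → (Fin s → ℤ) → Fin s → Fin m → List (Edge m)
  edgeAt m ε t j with (A ε t ⊔ B ε t) ≤? toℕ j
  ... | yes _ = [ edge (minus j (A ε t) , t) (minus j (B ε t) , next t)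
                       (+ A ε t ℤ.- + B ε t) ]
  ... | no  _ = []

  markAt : ∀ m → (Fin s → ℤ) → Fin s → Fin m → List (Vertex m)
  markAt m ε t j with A ε t ≤? toℕ j | suc (toℕ j) ≤? B ε t
                    | B ε t ≤? toℕ j | suc (toℕ j) ≤? A ε t
  ... | yes _ | yes _ | _ | _ = [ (minus j (A ε t) , t) ]
  ... | _ | _ | yes _ | yes _ = [ (minus j (B ε t) , next t) ]
  ... | _ | _ | _ | _ = []

  -- all edges of Γ^m_ε (as a list; multi-edges kept with multiplicity)
  edges : ∀ m → (Fin s → ℤ) → List (Edge m)
  edges m ε with s ≟ 1
  ... | yes _ with ε (0 mod s) ℤ.≟ + 0
  ...   | yes _ = map (λ i → edge (i , 0 mod s) (i , 0 mod s) (+ 0)) (allFin m)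
  ...   | no  _ = []
  edges m ε | no _ =
    concatMap (λ t → concatMap (λ j → edgeAt m ε t j) (allFin m)) (allFin s)

  -- vertices marked zero (not needed for c, included for completeness)
  markedZero : ∀ m → (Fin s → ℤ) → List (Vertex m)
  markedZero m ε with s ≟ 1
  ... | yes _ with ε (0 mod s) ℤ.≟ + 0
  ...   | yes _ = []
  ...   | no  _ = concatMap (λ i → map (λ t → (i , t)) (allFin s)) (allFin m)
  markedZero m ε | no _ =
    concatMap (λ t → concatMap (λ j → markAt m ε t j) (allFin m)) (allFin s)

  module _ (m : ℕ) (ε : Fin s → ℤ) where

    arcs : List (Vertex m × Vertex m)
    arcs = map (λ e → src e , tgt e) (edges m ε)

    Adj : Vertex m → Vertex m → Set
    Adj u v = (u , v) ∈ arcs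

    Conn : Vertex m → Vertex m → Set
    Conn = Star (SymClosure Adj)

    decV : (u v : Vertex m × Vertex m) → _
    decV = ≡-dec (≡-dec FP._≟_ FP._≟_) (≡-dec FP._≟_ FP._≟_)

    mult : Vertex m × Vertex m → List (Vertex m × Vertex m) → ℕ
    mult p []       = 0
    mult p (q ∷ qs) with decV p q
    ... | yes _ = suc (mult p qs)
    ... | no  _ = mult p qs

    cycleArcs : List (Vertex m) → List (Vertex m × Vertex m)
    cycleArcs []       = []
    cycleArcs (x ∷ xs) = zip (x ∷ xs) (xs ++ [ x ])

    CycleComponent : Vertex m → Set
    CycleComponent v =
      Σ (List (Vertex m)) λ L →
        ¬ (L ≡ [])
        × Unique L
        × (∀ w → Conn v w ⇔ w ∈ L)
        × (∀ a b → a ∈ L → mult (a , b) arcs ≡ mult (a , b) (cycleArcs L))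

    rank : Vertex m → ℕ
    rank (i , t) = toℕ i ℕ.* s ℕ.+ toℕ t

    Representative : Vertex m → Set
    Representative v = ∀ w → Conn v w → rank v ℕ.≤ rank w

    -- c(Γ^m_ε) = n : there are exactly n cycle components, counted via
    -- their unique least vertices.
    NumCycleComponents : ℕ → Set
    NumCycleComponents n =
      Σ (List (Vertex m)) λ R →
        Unique R
        × (∀ v → v ∈ R ⇔ (Representative v × CycleComponent v))
        × length R ≡ n

module Submission where

-- Write A_t = max(ε_t,0), d_t = max(-ε_t,0) (so B_t = d_{t+1}), and let the height
-- h_t be the prefix sum ε_0 + ⋯ + ε_{t-1} minus its minimum.  Then
-- h_{t+1} + d_t = h_t + A_t, and the level conditions give h ≤ λ with equality somewhere.
--  (1) x_{i,t} has an out-arc iff B_t ≤ i + A_t < m; it is then unique (multiplicity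
--      one) and goes to the successor x_{i+A_t-B_t, t+1}.
--  (2) The potential i + d_t - h_t of x_{i,t} is preserved by arcs, so it is
--      constant on components.
--  (3) For k < m ∸ λ the vertices w_k(t) = x_{k+h_t-d_t, t} form a directed cycle
--      which is the whole component of potential k.
--  (4) A cycle component has an out-arc at every vertex and meets every column;
--      before a column with h = λ this forces its potential p to satisfy
--      p + λ < m, so the component is one of the cycles in (3).
-- Each cycle is counted by its least vertex w_k(t_S).  Nothing uses ε_i ∈ {1,0,-1}.

open import Defs
open import Data.Nat using (ℕ; _≤_; _∸_; NonZero)
open import Data.Integer using (ℤ; +_; -_)
open import Data.Fin using (Fin)
open import Data.Sum using (_⊎_)
open import Relation.Binary.PropositionalEquality using (_≡_)

open import Data.Nat as N using (zero; suc; _+_; _*_; _<_; _⊔_; z≤n; s≤s; _%_)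
import Data.Nat.Properties as NP
import Data.Nat.DivMod as DM
open import Data.Nat.Tactic.RingSolver using () renaming (solve-∀ to solveℕ)
import Data.Integer as Z
import Data.Integer.Properties as ZP
open import Data.Integer.Tactic.RingSolver using () renaming (solve-∀ to solveℤ)
open import Data.Fin as F using (toℕ; fromℕ<)
import Data.Fin.Properties as FP
open import Data.Product using (Σ; _×_; _,_; proj₁; proj₂)
open import Data.Sum using (inj₁; inj₂)
open import Data.Empty using (⊥-elim)
open import Data.List using (List; []; _∷_; _++_; [_]; map; tabulate; allFin; concatMap; length; zip)
import Data.List.Properties as LP
import Data.List.Extrema as Extrema
import Data.List.Relation.Unary.All as All
open import Data.List.Relation.Unary.Any using (here; there)
open import Data.List.Membership.Propositional using (_∈_; _∉_)
open import Data.List.Membership.Propositional.Properties using (∈-tabulate⁺; ∈-tabulate⁻; ∈-allFin)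
open import Data.List.Relation.Unary.Unique.Propositional using (Unique)
open import Data.List.Relation.Unary.Unique.Propositional.Properties using (tabulate⁺)
open import Relation.Binary.Bundles using (TotalOrder)
open import Relation.Binary.Construct.Closure.ReflexiveTransitive using (_◅_; _◅◅_) renaming (ε to nil)
open import Relation.Binary.Construct.Closure.Symmetric using (fwd; bwd)
open import Relation.Binary.PropositionalEquality using (refl; sym; trans; cong; cong₂; subst; subst₂; _≢_; module ≡-Reasoning)
open import Relation.Nullary using (yes; no; ¬_; Dec)
open import Relation.Nullary.Decidable using (_×-dec_)
open import Function using (_∘_; id)
open import Function.Bundles using (_⇔_; mk⇔; Equivalence)

-- A function on a nonempty finite set, valued in a total order, attains its minimum.
-- (Kept abstract: only this specification is used, and unfolding the search would
-- make normalisation of goals mentioning the minimiser expensive.)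
abstract
  minimiser : ∀ {c ℓ₁ ℓ₂} (O : TotalOrder c ℓ₁ ℓ₂) {k} (f : Fin (suc k) → TotalOrder.Carrier O) →
    Σ (Fin (suc k)) λ t₀ → ∀ t → TotalOrder._≤_ O (f t₀) (f t)
  minimiser O {k} f = t₀ , λ t → All.lookup (f[argmin]≤f[xs] F.zero (allFin _)) (∈-allFin t)
    where
    open Extrema O
    t₀ : Fin (suc k)
    t₀ = argmin f F.zero (allFin _)

tabulate-snoc : ∀ {k} {X : Set} (f : Fin (suc k) → X) →
  tabulate f ≡ tabulate (f ∘ F.inject₁) ++ [ f (F.fromℕ k) ]
tabulate-snoc {zero} f = refl
tabulate-snoc {suc k} f = cong (f F.zero ∷_) (tabulate-snoc (f ∘ F.suc))

zip-tabulate : ∀ {k} {X Y : Set} (f : Fin k → X) (g : Fin k → Y) →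
  zip (tabulate f) (tabulate g) ≡ tabulate (λ t → f t , g t)
zip-tabulate {zero} f g = refl
zip-tabulate {suc k} f g = cong ((f F.zero , g F.zero) ∷_) (zip-tabulate (f ∘ F.suc) (g ∘ F.suc))

∈-zip-partner : ∀ {X Y : Set} {a : X} (xs : List X) (ys : List Y) → a ∈ xs →
  length xs ≤ length ys → Σ Y λ b → (a , b) ∈ zip xs ys
∈-zip-partner (x ∷ xs) (y ∷ ys) (here refl) _ = y , here refl
∈-zip-partner (x ∷ xs) (y ∷ ys) (there a∈xs) (s≤s le) with ∈-zip-partner xs ys a∈xs le
... | b , ab∈ = b , there ab∈

+-negPart : ∀ (x : ℤ) → x Z.+ + pos (Z.- x) ≡ + pos x
+-negPart (+ zero) = refl
+-negPart (+ suc k) = ZP.+-identityʳ (+ suc k)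
+-negPart Z.-[1+ k ] = ZP.n⊖n≡0 (suc k)

posPart∨negPart≡0 : ∀ (x : ℤ) → pos x ≡ 0 ⊎ pos (Z.- x) ≡ 0
posPart∨negPart≡0 (+ zero) = inj₁ refl
posPart∨negPart≡0 (+ suc k) = inj₂ refl
posPart∨negPart≡0 Z.-[1+ k ] = inj₁ refl

+-diff-≡ : ∀ (a b c e : ℕ) → a + b ≡ c + e → + a Z.- + e ≡ + c Z.- + b
+-diff-≡ a b c e eq = begin
    + a Z.- + e                       ≡⟨ shift (+ a) (+ b) (+ e) ⟩
    (+ a Z.+ + b) Z.- (+ b Z.+ + e)   ≡⟨ cong (Z._- (+ b Z.+ + e)) a+b≡c+e ⟩
    (+ c Z.+ + e) Z.- (+ b Z.+ + e)   ≡⟨ sym (shift′ (+ c) (+ b) (+ e)) ⟩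
    + c Z.- + b                       ∎
  where
  open ≡-Reasoning
  shift : ∀ (x y z : ℤ) → x Z.- z ≡ (x Z.+ y) Z.- (y Z.+ z)
  shift = solveℤ
  shift′ : ∀ (x y z : ℤ) → x Z.- y ≡ (x Z.+ z) Z.- (y Z.+ z)
  shift′ = solveℤ
  a+b≡c+e : + a Z.+ + b ≡ + c Z.+ + e
  a+b≡c+e = trans (sym (ZP.pos-+ a b)) (trans (cong +_ eq) (ZP.pos-+ c e))

diff≡⇒≡+ : ∀ (a b p : ℕ) → + a Z.- + b ≡ + p → a ≡ p + b
diff≡⇒≡+ a b p eq = ZP.+-injective (trans (undo (+ a) (+ b)) (trans (cong (Z._+ + b) eq) (sym (ZP.pos-+ p b))))
  where
  undo : ∀ (x y : ℤ) → x ≡ (x Z.- y) Z.+ y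
  undo = solveℤ

∣diff∣≡⇒ : ∀ p q L → Z.∣ + p Z.- + q ∣ ≡ L → p ≡ q + L ⊎ q ≡ p + L
∣diff∣≡⇒ p q L eq with q N.≤? p
... | yes q≤p = inj₁ (trans (sym (NP.m∸n+n≡m q≤p)) (trans (cong (_+ q) p∸q≡L) (NP.+-comm L q)))
  where
  p∸q≡L : p ∸ q ≡ L
  p∸q≡L = trans (cong Z.∣_∣ (sym (trans (ZP.m-n≡m⊖n p q) (ZP.⊖-≥ q≤p)))) eq
... | no q≰p = inj₂ (trans (sym (NP.m∸n+n≡m p≤q)) (trans (cong (_+ p) q∸p≡L) (NP.+-comm L p)))
  where
  p≤q : p ≤ q
  p≤q = NP.<⇒≤ (NP.≰⇒> q≰p)
  q∸p≡L : q ∸ p ≡ L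
  q∸p≡L = trans (sym (ZP.∣-i∣≡∣i∣ (+ (q ∸ p))))
            (trans (cong Z.∣_∣ (sym (trans (ZP.m-n≡m⊖n p q) (ZP.⊖-< (NP.≰⇒> q≰p))))) eq)

<∸⇒+< : ∀ k m l → k < m ∸ l → k + l < m
<∸⇒+< k m l lt = NP.m≤o∸n⇒m+n≤o (suc k) (NP.<⇒≤ l<m) lt
  where
  l<m : l < m
  l<m = NP.m∸n≢0⇒n<m (λ m∸l≡0 → NP.n≮0 (subst (k <_) m∸l≡0 lt))

module Columns (n : ℕ) where

  shiftCol : Fin (suc n) → ℕ → Fin (suc n)
  shiftCol t j = (toℕ t + j) DM.mod suc n

  toℕ-mod : ∀ k → k < suc n → toℕ (k DM.mod suc n) ≡ k
  toℕ-mod k k<s = trans (FP.toℕ-fromℕ< _) (DM.m<n⇒m%n≡m k<s)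

  mod-toℕ : ∀ (t : Fin (suc n)) → toℕ t DM.mod suc n ≡ t
  mod-toℕ t = FP.toℕ-injective (toℕ-mod (toℕ t) (FP.toℕ<n t))

  suc-%-% : ∀ x → suc (x % suc n) % suc n ≡ suc x % suc n
  suc-%-% x = trans (DM.%-distribˡ-+ 1 (x % suc n) (suc n))
    (trans (cong (λ z → (1 % suc n + z) % suc n) (DM.m%n%n≡m%n x (suc n)))
           (sym (DM.%-distribˡ-+ 1 x (suc n))))

  shiftCol-zero : ∀ t → shiftCol t 0 ≡ t
  shiftCol-zero t = trans (cong (DM._mod suc n) (NP.+-identityʳ (toℕ t))) (mod-toℕ t)

  next-shiftCol : ∀ t j → next (suc n) (shiftCol t j) ≡ shiftCol t (suc j)
  next-shiftCol t j = FP.toℕ-injective (begin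
    toℕ (next (suc n) (shiftCol t j)) ≡⟨ FP.toℕ-fromℕ< _ ⟩
    suc (toℕ (shiftCol t j)) % suc n  ≡⟨ cong (λ z → suc z % suc n) (FP.toℕ-fromℕ< _) ⟩
    suc ((toℕ t + j) % suc n) % suc n ≡⟨ suc-%-% (toℕ t + j) ⟩
    suc (toℕ t + j) % suc n           ≡⟨ cong (_% suc n) (sym (NP.+-suc (toℕ t) j)) ⟩
    (toℕ t + suc j) % suc n           ≡⟨ sym (FP.toℕ-fromℕ< _) ⟩
    toℕ (shiftCol t (suc j))          ∎)
    where open ≡-Reasoning

  shiftCol-onto : ∀ t t′ → Σ ℕ λ j → shiftCol t j ≡ t′
  shiftCol-onto t t′ = toℕ t′ + (suc n ∸ toℕ t) , FP.toℕ-injective (begin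
    toℕ (shiftCol t (toℕ t′ + (suc n ∸ toℕ t)))  ≡⟨ FP.toℕ-fromℕ< _ ⟩
    (toℕ t + (toℕ t′ + (suc n ∸ toℕ t))) % suc n ≡⟨ cong (_% suc n) (swap (toℕ t) (toℕ t′) (suc n ∸ toℕ t)) ⟩
    (toℕ t′ + (toℕ t + (suc n ∸ toℕ t))) % suc n ≡⟨ cong (λ z → (toℕ t′ + z) % suc n) (NP.m+[n∸m]≡n (NP.<⇒≤ (FP.toℕ<n t))) ⟩
    (toℕ t′ + suc n) % suc n                     ≡⟨ DM.[m+n]%n≡m%n (toℕ t′) (suc n) ⟩
    toℕ t′ % suc n                               ≡⟨ DM.m<n⇒m%n≡m (FP.toℕ<n t′) ⟩
    toℕ t′                                       ∎)
    where
    open ≡-Reasoning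
    swap : ∀ a b c → a + (b + c) ≡ b + (a + c)
    swap = solveℕ

  next-onto : ∀ t → Σ (Fin (suc n)) λ t′ → next (suc n) t′ ≡ t
  next-onto t = shiftCol t n , trans (next-shiftCol t n) (FP.toℕ-injective (begin
    toℕ (shiftCol t (suc n))  ≡⟨ FP.toℕ-fromℕ< _ ⟩
    (toℕ t + suc n) % suc n   ≡⟨ DM.[m+n]%n≡m%n (toℕ t) (suc n) ⟩
    toℕ t % suc n             ≡⟨ DM.m<n⇒m%n≡m (FP.toℕ<n t) ⟩
    toℕ t                     ∎))
    where open ≡-Reasoning

  next-inject₁ : ∀ (i : Fin n) → next (suc n) (F.inject₁ i) ≡ F.suc i
  next-inject₁ i = FP.toℕ-injective (trans (FP.toℕ-fromℕ< _)
    (trans (cong (λ z → suc z % suc n) (FP.toℕ-inject₁ i)) (DM.m<n⇒m%n≡m (s≤s (FP.toℕ<n i)))))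

  next-last : next (suc n) (F.fromℕ n) ≡ F.zero
  next-last = FP.toℕ-injective (trans (FP.toℕ-fromℕ< _)
    (trans (cong (λ z → suc z % suc n) (FP.toℕ-fromℕ n)) (DM.n%n≡0 (suc n))))

module Graph (n m : ℕ) (ε : Fin (suc n) → ℤ) where

  Vtx : Set
  Vtx = Vertex (suc n) m

  Arc : Set
  Arc = Vtx × Vtx

  count : Arc → List Arc → ℕ
  count = mult (suc n) m ε

  arcsOf : List (Edge (suc n) m) → List Arc
  arcsOf = map (λ e → src e , tgt e)

  count-++ : ∀ p xs ys → count p (xs ++ ys) ≡ count p xs + count p ys
  count-++ p [] ys = refl
  count-++ p (q ∷ xs) ys with decV (suc n) m ε p q
  ... | yes _ = cong suc (count-++ p xs ys)
  ... | no _ = count-++ p xs ys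

  count-∉ : ∀ {p} xs → p ∉ xs → count p xs ≡ 0
  count-∉ [] _ = refl
  count-∉ {p} (q ∷ xs) p∉ with decV (suc n) m ε p q
  ... | yes p≡q = ⊥-elim (p∉ (here p≡q))
  ... | no _ = count-∉ xs (p∉ ∘ there)

  count-∈ : ∀ {p xs} → p ∈ xs → 1 ≤ count p xs
  count-∈ {p} {q ∷ xs} p∈ with decV (suc n) m ε p q | p∈
  ... | yes _ | _ = s≤s z≤n
  ... | no p≢q | here p≡q = ⊥-elim (p≢q p≡q)
  ... | no _ | there p∈xs = count-∈ p∈xs

  count≥1⇒∈ : ∀ {p} xs → 1 ≤ count p xs → p ∈ xs
  count≥1⇒∈ {p} (q ∷ xs) ge with decV (suc n) m ε p q
  ... | yes p≡q = here p≡q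
  ... | no _ = there (count≥1⇒∈ xs ge)

  count-self : ∀ p → count p [ p ] ≡ 1
  count-self p with decV (suc n) m ε p p
  ... | yes _ = refl
  ... | no p≢p = ⊥-elim (p≢p refl)

  count-singleton⇒≡ : ∀ {p} q → 1 ≤ count p [ q ] → p ≡ q
  count-singleton⇒≡ q ge with count≥1⇒∈ [ q ] ge
  ... | here p≡q = p≡q

  count-tabulate-∉ : ∀ {k} (f : Fin k → Arc) p → (∀ x → p ≢ f x) → count p (tabulate f) ≡ 0
  count-tabulate-∉ f p p∉ = count-∉ (tabulate f) λ p∈ → let (x , p≡fx) = ∈-tabulate⁻ p∈ in p∉ x p≡fx

  count-tabulate : ∀ {k} (f : Fin k → Arc) p x₀ → (∀ x → x ≢ x₀ → p ≢ f x) →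
    count p (tabulate f) ≡ count p [ f x₀ ]
  count-tabulate f p F.zero only with decV (suc n) m ε p (f F.zero)
  ... | yes _ = cong suc (count-tabulate-∉ (f ∘ F.suc) p (λ x → only (F.suc x) (λ ())))
  ... | no _ = count-tabulate-∉ (f ∘ F.suc) p (λ x → only (F.suc x) (λ ()))
  count-tabulate f p (F.suc x₀) only with decV (suc n) m ε p (f F.zero)
  ... | yes p≡f0 = ⊥-elim (only F.zero (λ ()) p≡f0)
  ... | no _ = count-tabulate (f ∘ F.suc) p x₀ (λ x x≢ → only (F.suc x) (x≢ ∘ FP.suc-injective))

  countArcs-++ : ∀ p es fs → count p (arcsOf (es ++ fs)) ≡ count p (arcsOf es) + count p (arcsOf fs)
  countArcs-++ p es fs = trans (cong (count p) (LP.map-++ _ es fs)) (count-++ p (arcsOf es) (arcsOf fs))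

  countBlocks-zero : ∀ {k} {Y : Set} (g : Fin k → Y) (blk : Y → List (Edge (suc n) m)) p →
    (∀ x → count p (arcsOf (blk (g x))) ≡ 0) → count p (arcsOf (concatMap blk (tabulate g))) ≡ 0
  countBlocks-zero {zero} g blk p none = refl
  countBlocks-zero {suc k} g blk p none =
    trans (countArcs-++ p (blk (g F.zero)) _)
          (cong₂ _+_ (none F.zero) (countBlocks-zero (g ∘ F.suc) blk p (none ∘ F.suc)))

  countBlocks-single : ∀ {k} {Y : Set} (g : Fin k → Y) (blk : Y → List (Edge (suc n) m)) p x₀ →
    (∀ x → x ≢ x₀ → count p (arcsOf (blk (g x))) ≡ 0) →
    count p (arcsOf (concatMap blk (tabulate g))) ≡ count p (arcsOf (blk (g x₀)))
  countBlocks-single g blk p F.zero others =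
    trans (countArcs-++ p (blk (g F.zero)) _)
      (trans (cong (λ z → count p (arcsOf (blk (g F.zero))) + z)
                   (countBlocks-zero (g ∘ F.suc) blk p (λ x → others (F.suc x) (λ ()))))
             (NP.+-identityʳ _))
  countBlocks-single g blk p (F.suc x₀) others =
    trans (countArcs-++ p (blk (g F.zero)) _)
      (cong₂ _+_ (others F.zero (λ ()))
         (countBlocks-single (g ∘ F.suc) blk p x₀ (λ x x≢ → others (F.suc x) (x≢ ∘ FP.suc-injective))))

  cycleArcs-out : ∀ L a → a ∈ L → Σ Vtx λ b → (a , b) ∈ cycleArcs (suc n) m ε L
  cycleArcs-out (x ∷ xs) a a∈L = ∈-zip-partner (x ∷ xs) (xs ++ [ x ]) a∈L
    (NP.≤-reflexive (sym (trans (LP.length-++ xs) (NP.+-comm (length xs) 1))))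

  Aₜ : Fin (suc n) → ℕ
  Aₜ = A (suc n) ε

  Bₜ : Fin (suc n) → ℕ
  Bₜ = B (suc n) ε

  HasOut : Vtx → Set
  HasOut (i , t) = Bₜ t ≤ toℕ i + Aₜ t × toℕ i + Aₜ t < m

  hasOut? : ∀ v → Dec (HasOut v)
  hasOut? (i , t) = (Bₜ t N.≤? toℕ i + Aₜ t) ×-dec (toℕ i + Aₜ t N.<? m)

  successor : ∀ (i : Fin m) t → .(toℕ i + Aₜ t < m) → Vtx
  successor i t lt = fromℕ< (NP.≤-<-trans (NP.m∸n≤m (toℕ i + Aₜ t) (Bₜ t)) lt) , next (suc n) t

  toℕ-minus : ∀ {k} (j : Fin k) a → toℕ (minus (suc n) j a) ≡ toℕ j ∸ a
  toℕ-minus j a = FP.toℕ-fromℕ< (NP.≤-<-trans (NP.m∸n≤m (toℕ j) a) (FP.toℕ<n j))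

  edgeAt-source : ∀ {i t b} t′ j → ((i , t) , b) ∈ arcsOf (edgeAt (suc n) m ε t′ j) →
    t′ ≡ t × toℕ j ≡ toℕ i + Aₜ t × Bₜ t ≤ toℕ j
  edgeAt-source t′ j mem with (Aₜ t′ ⊔ Bₜ t′) N.≤? toℕ j
  edgeAt-source t′ j (here refl) | yes A⊔B≤j =
    refl , sym (trans (cong (_+ Aₜ t′) (toℕ-minus j (Aₜ t′))) (NP.m∸n+n≡m (NP.≤-trans (NP.m≤m⊔n (Aₜ t′) (Bₜ t′)) A⊔B≤j))) ,
    NP.≤-trans (NP.m≤n⊔m (Aₜ t′) (Bₜ t′)) A⊔B≤j
  edgeAt-source t′ j () | no _

  edgeAt-arc : ∀ i t j → toℕ j ≡ toℕ i + Aₜ t → Bₜ t ≤ toℕ i + Aₜ t → (lt : toℕ i + Aₜ t < m) →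
    arcsOf (edgeAt (suc n) m ε t j) ≡ [ ((i , t) , successor i t lt) ]
  edgeAt-arc i t j j≡ B≤i+A lt with (Aₜ t ⊔ Bₜ t) N.≤? toℕ j
  ... | no A⊔B≰j = ⊥-elim (A⊔B≰j (subst (_ ≤_) (sym j≡) (NP.⊔-lub (NP.m≤n+m (Aₜ t) (toℕ i)) B≤i+A)))
  ... | yes _ = cong [_] (cong₂ _,_ (cong (_, t) (FP.toℕ-injective source≡))
                                    (cong (_, next _ t) (FP.toℕ-injective target≡)))
    where
    source≡ : toℕ (minus (suc n) j (Aₜ t)) ≡ toℕ i
    source≡ = trans (toℕ-minus j (Aₜ t)) (trans (cong (_∸ Aₜ t) j≡) (NP.m+n∸n≡m (toℕ i) (Aₜ t)))
    target≡ : toℕ (minus (suc n) j (Bₜ t)) ≡ toℕ (proj₁ (successor i t lt))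
    target≡ = trans (toℕ-minus j (Bₜ t)) (trans (cong (_∸ Bₜ t) j≡) (sym (FP.toℕ-fromℕ< _)))

-- With one column the condition Σε = 0 says ε₀ = 0, so every vertex has an out-arc.
oneColumn-ε≡0 : ∀ (ε : Fin 1 → ℤ) → totalSum 1 ε ≡ + 0 → ε F.zero ≡ + 0
oneColumn-ε≡0 ε Σε≡0 = trans (sym (ZP.+-identityʳ (ε F.zero))) Σε≡0

oneColumn-hasOut : ∀ m (ε : Fin 1 → ℤ) → totalSum 1 ε ≡ + 0 → ∀ i → Graph.HasOut zero m ε (i , F.zero)
oneColumn-hasOut m ε Σε≡0 i rewrite oneColumn-ε≡0 ε Σε≡0 =
  z≤n , subst (_< m) (sym (NP.+-identityʳ (toℕ i))) (FP.toℕ<n i)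

oneColumn-arcs : ∀ m (ε : Fin 1 → ℤ) → ε F.zero ≡ + 0 →
  arcs 1 m ε ≡ tabulate (λ x → (x , F.zero) , (x , F.zero))
oneColumn-arcs m ε ε₀≡0 with ε F.zero Z.≟ + 0
... | no ε₀≢0 = ⊥-elim (ε₀≢0 ε₀≡0)
... | yes _ = trans (cong (map (λ e → src e , tgt e)) (LP.map-tabulate id loop)) (LP.map-tabulate loop _)
  where
  loop : Fin m → Edge 1 m
  loop x = edge (x , F.zero) (x , F.zero) (+ 0)

noOutArc : ∀ n m (ε : Fin (suc n) → ℤ) → totalSum (suc n) ε ≡ + 0 → ∀ v b →
  ¬ Graph.HasOut n m ε v → Graph.count n m ε (v , b) (arcs (suc n) m ε) ≡ 0
noOutArc zero m ε Σε≡0 (i , F.zero) b ¬out = ⊥-elim (¬out (oneColumn-hasOut m ε Σε≡0 i))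
noOutArc (suc n) m ε _ (i , t) b ¬out =
  countBlocks-zero id (λ t′ → concatMap (edgeAt _ m ε t′) (allFin m)) _ λ t′ →
  countBlocks-zero id (edgeAt _ m ε t′) _ λ j → count-∉ _ λ mem →
    let (_ , j≡i+A , B≤j) = edgeAt-source t′ j mem
    in ¬out (subst (Bₜ t ≤_) j≡i+A B≤j , subst (_< m) j≡i+A (FP.toℕ<n j))
  where open Graph (suc n) m ε

outArc : ∀ n m (ε : Fin (suc n) → ℤ) → totalSum (suc n) ε ≡ + 0 → ∀ i t b →
  (out : Graph.HasOut n m ε (i , t)) →
  Graph.count n m ε ((i , t) , b) (arcs (suc n) m ε) ≡
  Graph.count n m ε ((i , t) , b) [ ((i , t) , Graph.successor n m ε i t (proj₂ out)) ]
outArc zero m ε Σε≡0 i F.zero b out = begin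
    count p (arcs 1 m ε)                   ≡⟨ cong (count p) (oneColumn-arcs m ε ε₀≡0) ⟩
    count p (tabulate loop)                ≡⟨ count-tabulate loop p i (λ x x≢i e → x≢i (sym (cong (proj₁ ∘ proj₁) e))) ⟩
    count p [ loop i ]                     ≡⟨ cong (λ v → count p [ ((i , F.zero) , v) ]) loop≡successor ⟩
    count p [ ((i , F.zero) , successor i F.zero (proj₂ out)) ] ∎
  where
  open Graph zero m ε
  open ≡-Reasoning
  p : Arc
  p = ((i , F.zero) , b)
  loop : Fin m → Arc
  loop x = (x , F.zero) , (x , F.zero)
  ε₀≡0 : ε F.zero ≡ + 0
  ε₀≡0 = oneColumn-ε≡0 ε Σε≡0
  loop≡successor : (i , F.zero) ≡ successor i F.zero (proj₂ out)
  loop≡successor = cong (_, F.zero) (FP.toℕ-injective (sym (trans (FP.toℕ-fromℕ< _)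
    (trans (cong₂ (λ x y → toℕ i + x ∸ y) (cong pos ε₀≡0) (cong (pos ∘ Z.-_) ε₀≡0)) (NP.+-identityʳ (toℕ i))))))
outArc (suc n) m ε _ i t b (B≤i+A , i+A<m) =
  trans (countBlocks-single id column p t otherColumn)
        (trans (countBlocks-single id (edgeAt _ m ε t) p j₀ otherRow) atJ₀)
  where
  open Graph (suc n) m ε
  p : Arc
  p = ((i , t) , b)
  column : Fin (suc (suc n)) → List (Edge (suc (suc n)) m)
  column t′ = concatMap (edgeAt _ m ε t′) (allFin m)
  j₀ : Fin m
  j₀ = fromℕ< i+A<m
  j₀≡ : toℕ j₀ ≡ toℕ i + Aₜ t
  j₀≡ = FP.toℕ-fromℕ< i+A<m
  onlyFrom : ∀ t′ j → p ∈ arcsOf (edgeAt _ m ε t′ j) → t′ ≡ t × j ≡ j₀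
  onlyFrom t′ j mem with edgeAt-source t′ j mem
  ... | t′≡t , j≡ , _ = t′≡t , FP.toℕ-injective (trans j≡ (sym j₀≡))
  otherColumn : ∀ t′ → t′ ≢ t → count p (arcsOf (column t′)) ≡ 0
  otherColumn t′ t′≢t = countBlocks-zero id (edgeAt _ m ε t′) p λ j → count-∉ _ (t′≢t ∘ proj₁ ∘ onlyFrom t′ j)
  otherRow : ∀ j → j ≢ j₀ → count p (arcsOf (edgeAt _ m ε t j)) ≡ 0
  otherRow j j≢j₀ = count-∉ _ (j≢j₀ ∘ proj₂ ∘ onlyFrom t j)
  atJ₀ : count p (arcsOf (edgeAt _ m ε t j₀)) ≡ count p [ ((i , t) , successor i t i+A<m) ]
  atJ₀ = cong (count p) (edgeAt-arc i t j₀ j₀≡ B≤i+A i+A<m)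

module Heights (n : ℕ) (ε : Fin (suc n) → ℤ) (Σε≡0 : totalSum (suc n) ε ≡ + 0) where
  open Columns n

  blockSum : ℕ → ℕ → ℤ
  blockSum o zero = + 0
  blockSum o (suc k) = ε ((o + k) DM.mod suc n) Z.+ blockSum o k

  circSum≡blockSum : ∀ a ℓ → circSum (suc n) ε a ℓ ≡ blockSum (toℕ a) ℓ
  circSum≡blockSum a zero = refl
  circSum≡blockSum a (suc ℓ) = cong (λ z → ε ((toℕ a + ℓ) DM.mod suc n) Z.+ z) (circSum≡blockSum a ℓ)

  blockSum-first : ∀ o k → blockSum o (suc k) ≡ ε (o DM.mod suc n) Z.+ blockSum (suc o) k
  blockSum-first o zero = cong (λ z → ε (z DM.mod suc n) Z.+ + 0) (NP.+-identityʳ o)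
  blockSum-first o (suc k) =
    trans (cong₂ Z._+_ (cong (λ z → ε (z DM.mod suc n)) (NP.+-suc o k)) (blockSum-first o k))
          (swap (ε (suc (o + k) DM.mod suc n)) (ε (o DM.mod suc n)) (blockSum (suc o) k))
    where
    swap : ∀ (x y z : ℤ) → x Z.+ (y Z.+ z) ≡ y Z.+ (x Z.+ z)
    swap = solveℤ

  sumℤ-consecutive : ∀ k o (g : Fin k → Fin (suc n)) → (∀ j → toℕ (g j) ≡ o + toℕ j) →
    sumℤ (map ε (tabulate g)) ≡ blockSum o k
  sumℤ-consecutive zero o g g≡ = refl
  sumℤ-consecutive (suc k) o g g≡ =
    trans (cong₂ Z._+_ (cong ε g₀≡) (sumℤ-consecutive k (suc o) (g ∘ F.suc) (λ j → trans (g≡ (F.suc j)) (NP.+-suc o (toℕ j)))))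
          (sym (blockSum-first o k))
    where
    toℕ-g₀ : toℕ (g F.zero) ≡ o
    toℕ-g₀ = trans (g≡ F.zero) (NP.+-identityʳ o)
    g₀≡ : g F.zero ≡ o DM.mod suc n
    g₀≡ = FP.toℕ-injective (trans toℕ-g₀ (sym (toℕ-mod o (subst (_< suc n) toℕ-g₀ (FP.toℕ<n (g F.zero))))))

  prefix : ℕ → ℤ
  prefix = blockSum 0

  prefix-total : prefix (suc n) ≡ + 0
  prefix-total = trans (sym (sumℤ-consecutive (suc n) 0 id (λ j → refl))) Σε≡0

  prefix-periodic : ∀ k → prefix (suc n + k) ≡ prefix k
  prefix-periodic zero = trans (cong prefix (NP.+-identityʳ (suc n))) prefix-total
  prefix-periodic (suc k) = trans (cong prefix (NP.+-suc (suc n) k))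
    (cong₂ Z._+_ (cong ε mod-periodic) (prefix-periodic k))
    where
    mod-periodic : (suc n + k) DM.mod suc n ≡ k DM.mod suc n
    mod-periodic = FP.toℕ-injective (trans (FP.toℕ-fromℕ< _)
      (trans (cong (_% suc n) (NP.+-comm (suc n) k)) (trans (DM.[m+n]%n≡m%n k (suc n)) (sym (FP.toℕ-fromℕ< _)))))

  blockSum-+prefix : ∀ a ℓ → blockSum a ℓ Z.+ prefix a ≡ prefix (a + ℓ)
  blockSum-+prefix a zero = trans (ZP.+-identityˡ _) (cong prefix (sym (NP.+-identityʳ a)))
  blockSum-+prefix a (suc ℓ) = trans (ZP.+-assoc (ε ((a + ℓ) DM.mod suc n)) _ _)
    (trans (cong (λ z → ε ((a + ℓ) DM.mod suc n) Z.+ z) (blockSum-+prefix a ℓ)) (cong prefix (sym (NP.+-suc a ℓ))))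

  P : Fin (suc n) → ℤ
  P t = prefix (toℕ t)

  prefix-mod : ∀ k → k ≤ suc n → P (k DM.mod suc n) ≡ prefix k
  prefix-mod k k≤s with k N.<? suc n
  ... | yes k<s = cong prefix (toℕ-mod k k<s)
  ... | no k≮s = subst (λ k′ → P (k′ DM.mod suc n) ≡ prefix k′) s≡k
        (trans (cong prefix (trans (FP.toℕ-fromℕ< _) (DM.n%n≡0 (suc n)))) (sym prefix-total))
    where
    s≡k : suc n ≡ k
    s≡k = NP.≤-antisym (NP.≮⇒≥ k≮s) k≤s

  P-next : ∀ t → P (next (suc n) t) ≡ P t Z.+ ε t
  P-next t = trans (prefix-mod (suc (toℕ t)) (FP.toℕ<n t))
    (trans (cong (Z._+ P t) (cong ε (mod-toℕ t))) (ZP.+-comm (ε t) (P t)))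

  blockEnd : ∀ (a : Fin (suc n)) ℓ → ℓ ≤ suc n → Σ (Fin (suc n)) λ t′ → prefix (toℕ a + ℓ) ≡ P t′
  blockEnd a ℓ ℓ≤s with (toℕ a + ℓ) N.<? suc n
  ... | yes lt = fromℕ< lt , cong prefix (sym (FP.toℕ-fromℕ< lt))
  ... | no a+ℓ≮s = fromℕ< r<s , trans (cong prefix (sym s+r≡)) (trans (prefix-periodic r) (cong prefix (sym (FP.toℕ-fromℕ< r<s))))
    where
    r : ℕ
    r = toℕ a + ℓ ∸ suc n
    s+r≡ : suc n + r ≡ toℕ a + ℓ
    s+r≡ = NP.m+[n∸m]≡n (NP.≮⇒≥ a+ℓ≮s)
    r<s : r < suc n
    r<s = NP.+-cancelˡ-< (suc n) r (suc n) (subst (_< suc n + suc n) (sym s+r≡) (NP.+-mono-<-≤ (FP.toℕ<n a) ℓ≤s))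

  t₀ : Fin (suc n)
  t₀ = proj₁ (minimiser ZP.≤-totalOrder P)

  h : Fin (suc n) → ℕ
  h t = Z.∣ P t Z.- P t₀ ∣

  +h≡ : ∀ t → + h t ≡ P t Z.- P t₀
  +h≡ t = ZP.0≤i⇒+∣i∣≡i (subst (Z._≤ P t Z.- P t₀) (ZP.+-inverseʳ (P t₀))
                          (ZP.+-monoˡ-≤ (Z.- P t₀) (proj₂ (minimiser ZP.≤-totalOrder P) t)))

  h-t₀ : h t₀ ≡ 0
  h-t₀ = cong Z.∣_∣ (ZP.+-inverseʳ (P t₀))

  d : Fin (suc n) → ℕ
  d t = pos (Z.- ε t)

  h-next : ∀ t → h (next (suc n) t) + d t ≡ h t + A (suc n) ε t
  h-next t = ZP.+-injective (begin
      + (h (next (suc n) t) + d t)             ≡⟨ ZP.pos-+ (h (next (suc n) t)) (d t) ⟩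
      + h (next (suc n) t) Z.+ + d t           ≡⟨ cong (Z._+ + d t) (trans (+h≡ (next (suc n) t)) (cong (Z._- P t₀) (P-next t))) ⟩
      (P t Z.+ ε t Z.- P t₀) Z.+ + d t         ≡⟨ regroup (P t) (ε t) (P t₀) (+ d t) ⟩
      (P t Z.- P t₀) Z.+ (ε t Z.+ + d t)       ≡⟨ cong₂ Z._+_ (sym (+h≡ t)) (+-negPart (ε t)) ⟩
      + h t Z.+ + A (suc n) ε t                ≡⟨ sym (ZP.pos-+ (h t) (A (suc n) ε t)) ⟩
      + (h t + A (suc n) ε t)                  ∎)
    where
    open ≡-Reasoning
    regroup : ∀ (x e μ z : ℤ) → (x Z.+ e Z.- μ) Z.+ z ≡ (x Z.- μ) Z.+ (e Z.+ z)
    regroup = solveℤ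

  d≤h : ∀ t → d t ≤ h t
  d≤h t with posPart∨negPart≡0 (ε t)
  ... | inj₂ d≡0 = subst (_≤ h t) (sym d≡0) z≤n
  ... | inj₁ A≡0 = subst (d t ≤_) (trans (h-next t) (trans (cong (λ z → h t + z) A≡0) (NP.+-identityʳ (h t))))
                          (NP.m≤n+m (d t) (h (next (suc n) t)))

  circSum≡hdiff : ∀ a ℓ t → prefix (toℕ a + ℓ) ≡ P t → circSum (suc n) ε a ℓ ≡ + h t Z.- + h a
  circSum≡hdiff a ℓ t end = begin
      circSum (suc n) ε a ℓ                 ≡⟨ circSum≡blockSum a ℓ ⟩
      blockSum (toℕ a) ℓ                    ≡⟨ undo (blockSum (toℕ a) ℓ) (P a) ⟩
      (blockSum (toℕ a) ℓ Z.+ P a) Z.- P a  ≡⟨ cong (Z._- P a) (trans (blockSum-+prefix (toℕ a) ℓ) end) ⟩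
      P t Z.- P a                           ≡⟨ rebase (P t) (P a) (P t₀) ⟩
      (P t Z.- P t₀) Z.- (P a Z.- P t₀)     ≡⟨ sym (cong₂ Z._-_ (+h≡ t) (+h≡ a)) ⟩
      + h t Z.- + h a                       ∎
    where
    open ≡-Reasoning
    undo : ∀ (x y : ℤ) → x ≡ (x Z.+ y) Z.- y
    undo = solveℤ
    rebase : ∀ (x y μ : ℤ) → x Z.- y ≡ (x Z.- μ) Z.- (y Z.- μ)
    rebase = solveℤ

module Levels (n : ℕ) (ε : Fin (suc n) → ℤ) (λε : ℕ) (circ : IsCircularOfLevel (suc n) ε λε) where
  open Heights n ε (proj₁ circ)

  bounded : ∀ (a : Fin (suc n)) ℓ → 1 ≤ ℓ → ℓ ≤ suc n → Z.∣ circSum (suc n) ε a ℓ ∣ ≤ λε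
  bounded = proj₁ (proj₂ circ)

  h≡blockFrom-t₀ : ∀ ℓ t → prefix (toℕ t₀ + ℓ) ≡ P t → circSum (suc n) ε t₀ ℓ ≡ + h t
  h≡blockFrom-t₀ ℓ t end = trans (circSum≡hdiff t₀ ℓ t end)
    (trans (cong (λ z → + h t Z.- + z) h-t₀) (ZP.+-identityʳ (+ h t)))

  h≤λ-via-block : ∀ ℓ t → ℓ ≤ suc n → prefix (toℕ t₀ + ℓ) ≡ P t → h t ≤ λε
  h≤λ-via-block zero t _ end = subst (_≤ λε) (ZP.+-injective (h≡blockFrom-t₀ zero t end)) z≤n
  h≤λ-via-block (suc ℓ) t ℓ≤s end =
    subst (_≤ λε) (cong Z.∣_∣ (h≡blockFrom-t₀ (suc ℓ) t end)) (bounded t₀ (suc ℓ) (s≤s z≤n) ℓ≤s)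

  h≤λ : ∀ t → h t ≤ λε
  h≤λ t with toℕ t₀ N.≤? toℕ t
  ... | yes t₀≤t = h≤λ-via-block (toℕ t ∸ toℕ t₀) t
        (NP.≤-trans (NP.m∸n≤m (toℕ t) (toℕ t₀)) (NP.<⇒≤ (FP.toℕ<n t)))
        (cong prefix (NP.m+[n∸m]≡n t₀≤t))
  ... | no t₀≰t = h≤λ-via-block ℓ t ℓ≤s (trans (cong prefix wraps) (prefix-periodic (toℕ t)))
    where
    ℓ : ℕ
    ℓ = (suc n ∸ toℕ t₀) + toℕ t
    t₀≤s : toℕ t₀ ≤ suc n
    t₀≤s = NP.<⇒≤ (FP.toℕ<n t₀)
    wraps : toℕ t₀ + ℓ ≡ suc n + toℕ t
    wraps = trans (sym (NP.+-assoc (toℕ t₀) _ (toℕ t))) (cong (_+ toℕ t) (NP.m+[n∸m]≡n t₀≤s))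
    ℓ≤s : ℓ ≤ suc n
    ℓ≤s = subst (ℓ ≤_) (NP.m∸n+n≡m t₀≤s) (NP.+-monoʳ-≤ (suc n ∸ toℕ t₀) (NP.<⇒≤ (NP.≰⇒> t₀≰t)))

  -- A block with |sum| = λ has an end of height λ.
  h-attains-λ : Σ (Fin (suc n)) λ t → h t ≡ λε
  h-attains-λ with proj₂ (proj₂ circ)
  ... | a , ℓ , _ , ℓ≤s , ∣Σ∣≡λ with blockEnd a ℓ ℓ≤s
  ... | t′ , end with ∣diff∣≡⇒ (h t′) (h a) λε (trans (cong Z.∣_∣ (sym (circSum≡hdiff a ℓ t′ end))) ∣Σ∣≡λ)
  ... | inj₁ ht′≡ = t′ , NP.≤-antisym (h≤λ t′) (subst (λε ≤_) (sym ht′≡) (NP.m≤n+m λε (h a)))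
  ... | inj₂ ha≡ = a , NP.≤-antisym (h≤λ a) (subst (λε ≤_) (sym ha≡) (NP.m≤n+m λε (h t′)))

module Components (n m : ℕ) (ε : Fin (suc n) → ℤ) (λε : ℕ) (circ : IsCircularOfLevel (suc n) ε λε) where
  open Columns n
  open Graph n m ε
  open Heights n ε (proj₁ circ)
  open Levels n ε λε circ

  Σε≡0 : totalSum (suc n) ε ≡ + 0
  Σε≡0 = proj₁ circ

  arc⇒successor : ∀ {a b} → Adj (suc n) m ε a b →
    Σ (HasOut a) λ out → b ≡ successor (proj₁ a) (proj₂ a) (proj₂ out)
  arc⇒successor {(i , t)} {b} a→b with hasOut? (i , t)
  ... | yes out = out , cong proj₂ (count-singleton⇒≡ {((i , t) , b)} ((i , t) , successor i t (proj₂ out))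
                    (subst (1 ≤_) (outArc n m ε Σε≡0 i t b out) (count-∈ {xs = arcs (suc n) m ε} a→b)))
  ... | no ¬out = ⊥-elim (NP.1+n≰n (subst (1 ≤_) (noOutArc n m ε Σε≡0 (i , t) b ¬out) (count-∈ {xs = arcs (suc n) m ε} a→b)))

  arc-successor : ∀ i t (out : HasOut (i , t)) → Adj (suc n) m ε (i , t) (successor i t (proj₂ out))
  arc-successor i t out = count≥1⇒∈ (arcs (suc n) m ε)
    (subst (1 ≤_) (sym (trans (outArc n m ε Σε≡0 i t b out) (count-self ((i , t) , b)))) NP.≤-refl)
    where
    b : Vtx
    b = successor i t (proj₂ out)

  +A≡+h-next : ∀ i t k → i + d t ≡ k + h t → i + Aₜ t ≡ k + h (next (suc n) t)
  +A≡+h-next i t k i+d≡k+h = NP.+-cancelʳ-≡ (d t) (i + Aₜ t) (k + h′) (begin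
    i + Aₜ t + d t    ≡⟨ swap i (Aₜ t) (d t) ⟩
    (i + d t) + Aₜ t  ≡⟨ cong (_+ Aₜ t) i+d≡k+h ⟩
    (k + h t) + Aₜ t  ≡⟨ NP.+-assoc k (h t) (Aₜ t) ⟩
    k + (h t + Aₜ t)  ≡⟨ cong (λ z → k + z) (sym (h-next t)) ⟩
    k + (h′ + d t)    ≡⟨ sym (NP.+-assoc k h′ (d t)) ⟩
    k + h′ + d t      ∎)
    where
    open ≡-Reasoning
    h′ : ℕ
    h′ = h (next (suc n) t)
    swap : ∀ a b c → a + b + c ≡ a + c + b
    swap = solveℕ

  pot : Vtx → ℤ
  pot (i , t) = + (toℕ i + d t) Z.- + h t

  pot-successor : ∀ i t (out : HasOut (i , t)) → pot (successor i t (proj₂ out)) ≡ pot (i , t)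
  pot-successor i t (B≤ , i+A<m) = trans (cong (λ z → + z Z.- + h (next (suc n) t)) row+d≡)
    (+-diff-≡ (toℕ i + Aₜ t) (h t) (toℕ i + d t) (h (next (suc n) t)) (begin
      toℕ i + Aₜ t + h t                     ≡⟨ NP.+-assoc (toℕ i) (Aₜ t) (h t) ⟩
      toℕ i + (Aₜ t + h t)                   ≡⟨ cong (λ z → toℕ i + z) (trans (NP.+-comm (Aₜ t) (h t)) (sym (h-next t))) ⟩
      toℕ i + (h (next (suc n) t) + d t)     ≡⟨ cong (λ z → toℕ i + z) (NP.+-comm _ (d t)) ⟩
      toℕ i + (d t + h (next (suc n) t))     ≡⟨ sym (NP.+-assoc (toℕ i) (d t) _) ⟩
      toℕ i + d t + h (next (suc n) t)       ∎))
    where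
    open ≡-Reasoning
    row+d≡ : toℕ (proj₁ (successor i t i+A<m)) + d (next (suc n) t) ≡ toℕ i + Aₜ t
    row+d≡ = trans (cong (_+ d (next (suc n) t)) (FP.toℕ-fromℕ< _)) (NP.m∸n+n≡m B≤)

  pot-arc : ∀ {a b} → Adj (suc n) m ε a b → pot a ≡ pot b
  pot-arc {(i , t)} a→b with arc⇒successor a→b
  ... | out , refl = sym (pot-successor i t out)

  pot-conn : ∀ {a b} → Conn (suc n) m ε a b → pot a ≡ pot b
  pot-conn nil = refl
  pot-conn (fwd a→c ◅ c~b) = trans (pot-arc a→c) (pot-conn c~b)
  pot-conn (bwd c→a ◅ c~b) = trans (sym (pot-arc c→a)) (pot-conn c~b)

  K : ℕ
  K = m ∸ λε

  k+h<m : ∀ (k : Fin K) t → toℕ k + h t < m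
  k+h<m k t = NP.≤-<-trans (NP.+-monoʳ-≤ (toℕ k) (h≤λ t)) (<∸⇒+< (toℕ k) m λε (FP.toℕ<n k))

  row< : ∀ (k : Fin K) t → toℕ k + h t ∸ d t < m
  row< k t = NP.≤-<-trans (NP.m∸n≤m _ (d t)) (k+h<m k t)

  w : Fin K → Fin (suc n) → Vtx
  w k t = fromℕ< (row< k t) , t

  w-row : ∀ k t → toℕ (proj₁ (w k t)) + d t ≡ toℕ k + h t
  w-row k t = trans (cong (_+ d t) (FP.toℕ-fromℕ< (row< k t)))
                    (NP.m∸n+n≡m (NP.≤-trans (d≤h t) (NP.m≤n+m (h t) (toℕ k))))

  w-hasOut : ∀ k t → HasOut (w k t)
  w-hasOut k t = subst (Bₜ t ≤_) (sym row+A≡) (NP.≤-trans (d≤h (next (suc n) t)) (NP.m≤n+m _ (toℕ k))) ,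
                 subst (_< m) (sym row+A≡) (k+h<m k (next (suc n) t))
    where
    row+A≡ : toℕ (proj₁ (w k t)) + Aₜ t ≡ toℕ k + h (next (suc n) t)
    row+A≡ = +A≡+h-next (toℕ (proj₁ (w k t))) t (toℕ k) (w-row k t)

  successor-w : ∀ k t → successor (proj₁ (w k t)) t (proj₂ (w-hasOut k t)) ≡ w k (next (suc n) t)
  successor-w k t = cong (_, next (suc n) t) (FP.toℕ-injective (trans (FP.toℕ-fromℕ< _)
      (trans (cong (_∸ Bₜ t) row+A≡) (sym (FP.toℕ-fromℕ< (row< k (next (suc n) t)))))))
    where
    row+A≡ : toℕ (proj₁ (w k t)) + Aₜ t ≡ toℕ k + h (next (suc n) t)
    row+A≡ = +A≡+h-next (toℕ (proj₁ (w k t))) t (toℕ k) (w-row k t)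

  arc-w : ∀ k t → Adj (suc n) m ε (w k t) (w k (next (suc n) t))
  arc-w k t = subst (Adj (suc n) m ε (w k t)) (successor-w k t) (arc-successor _ t (w-hasOut k t))

  pot-w : ∀ k t → pot (w k t) ≡ + toℕ k
  pot-w k t = trans (+-diff-≡ (toℕ (proj₁ (w k t)) + d t) 0 (toℕ k) (h t) (trans (NP.+-identityʳ _) (w-row k t)))
                    (ZP.+-identityʳ (+ toℕ k))

  pot⇒w : ∀ i t (k : Fin K) → pot (i , t) ≡ + toℕ k → (i , t) ≡ w k t
  pot⇒w i t k pot≡k = cong (_, t) (FP.toℕ-injective (begin
    toℕ i                   ≡⟨ sym (NP.m+n∸n≡m (toℕ i) (d t)) ⟩
    toℕ i + d t ∸ d t       ≡⟨ cong (_∸ d t) (diff≡⇒≡+ (toℕ i + d t) (h t) (toℕ k) pot≡k) ⟩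
    toℕ k + h t ∸ d t       ≡⟨ sym (FP.toℕ-fromℕ< (row< k t)) ⟩
    toℕ (proj₁ (w k t))     ∎))
    where open ≡-Reasoning

  conn-shift : ∀ k t j → Conn (suc n) m ε (w k t) (w k (shiftCol t j))
  conn-shift k t zero = subst (λ t′ → Conn (suc n) m ε (w k t) (w k t′)) (sym (shiftCol-zero t)) nil
  conn-shift k t (suc j) = conn-shift k t j ◅◅
    (fwd (subst (λ t′ → Adj (suc n) m ε (w k (shiftCol t j)) (w k t′)) (next-shiftCol t j) (arc-w k (shiftCol t j))) ◅ nil)

  conn-w : ∀ k t t′ → Conn (suc n) m ε (w k t) (w k t′)
  conn-w k t t′ with shiftCol-onto t t′
  ... | j , refl = conn-shift k t j

  cycleList : Fin K → List Vtx
  cycleList k = tabulate (w k)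

  cycleArcs-w : ∀ k → cycleArcs (suc n) m ε (cycleList k) ≡ tabulate (λ t → w k t , w k (next (suc n) t))
  cycleArcs-w k = trans (cong (zip (cycleList k)) rotate) (zip-tabulate (w k) (w k ∘ next (suc n)))
    where
    rotate : tabulate (w k ∘ F.suc) ++ [ w k F.zero ] ≡ tabulate (w k ∘ next (suc n))
    rotate = sym (trans (tabulate-snoc (w k ∘ next (suc n)))
      (cong₂ _++_ (LP.tabulate-cong (λ i → cong (w k) (next-inject₁ i))) (cong (λ x → [ w k x ]) next-last)))

  cycle-w : ∀ k t → CycleComponent (suc n) m ε (w k t)
  cycle-w k t = cycleList k , (λ ()) , tabulate⁺ {f = w k} (cong proj₂) , (λ x → mk⇔ (to x) (from x)) , sameArcs
    where
    to : ∀ x → Conn (suc n) m ε (w k t) x → x ∈ cycleList k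
    to (i′ , t′) c = subst (_∈ cycleList k) (sym (pot⇒w i′ t′ k (trans (sym (pot-conn c)) (pot-w k t))))
                           (∈-tabulate⁺ {f = w k} t′)
    from : ∀ x → x ∈ cycleList k → Conn (suc n) m ε (w k t) x
    from x x∈ with ∈-tabulate⁻ {f = w k} x∈
    ... | t′ , refl = conn-w k t t′
    sameArcs : ∀ a b → a ∈ cycleList k →
      count (a , b) (arcs (suc n) m ε) ≡ count (a , b) (cycleArcs (suc n) m ε (cycleList k))
    sameArcs a b a∈ with ∈-tabulate⁻ {f = w k} a∈
    ... | t′ , refl = begin
      count (w k t′ , b) (arcs (suc n) m ε)
        ≡⟨ outArc n m ε Σε≡0 (proj₁ (w k t′)) t′ b (w-hasOut k t′) ⟩
      count (w k t′ , b) [ (w k t′ , successor (proj₁ (w k t′)) t′ (proj₂ (w-hasOut k t′))) ]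
        ≡⟨ cong (λ x → count (w k t′ , b) [ (w k t′ , x) ]) (successor-w k t′) ⟩
      count (w k t′ , b) [ (w k t′ , w k (next (suc n) t′)) ]
        ≡⟨ sym (count-tabulate (λ t → w k t , w k (next (suc n) t)) (w k t′ , b) t′
                 (λ x x≢t′ e → x≢t′ (sym (cong (proj₂ ∘ proj₁) e)))) ⟩
      count (w k t′ , b) (tabulate (λ t → w k t , w k (next (suc n) t)))
        ≡⟨ cong (count (w k t′ , b)) (sym (cycleArcs-w k)) ⟩
      count (w k t′ , b) (cycleArcs (suc n) m ε (cycleList k)) ∎
      where open ≡-Reasoning

  module InCycle (v : Vtx) (L : List Vtx) (iff : ∀ x → Conn (suc n) m ε v x ⇔ x ∈ L)
    (sameArcs : ∀ a b → a ∈ L → count (a , b) (arcs (suc n) m ε) ≡ count (a , b) (cycleArcs (suc n) m ε L)) where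

    ∈⇒conn : ∀ {a} → a ∈ L → Conn (suc n) m ε v a
    ∈⇒conn {a} = Equivalence.from (iff a)

    pot-∈ : ∀ {a} → a ∈ L → pot a ≡ pot v
    pot-∈ a∈ = sym (pot-conn (∈⇒conn a∈))

    -- each vertex of the cycle has an out-arc, since it does in `cycleArcs`
    hasOut-∈ : ∀ {a} → a ∈ L → HasOut a
    hasOut-∈ {a} a∈ with hasOut? a
    ... | yes out = out
    ... | no ¬out with cycleArcs-out L a a∈
    ... | b , ab∈ = ⊥-elim (NP.1+n≰n (subst (1 ≤_)
          (trans (sym (sameArcs a b a∈)) (noOutArc n m ε Σε≡0 a b ¬out)) (count-∈ ab∈)))

    successor-∈ : ∀ {a} (a∈ : a ∈ L) → successor (proj₁ a) (proj₂ a) (proj₂ (hasOut-∈ a∈)) ∈ L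
    successor-∈ {(i , t)} a∈ = Equivalence.to (iff _) (∈⇒conn a∈ ◅◅ (fwd (arc-successor i t (hasOut-∈ a∈)) ◅ nil))

    -- following successors, the cycle meets every column
    reach : ∀ j → Σ Vtx λ a → a ∈ L × proj₂ a ≡ shiftCol (proj₂ v) j
    reach zero = v , Equivalence.to (iff v) nil , sym (shiftCol-zero (proj₂ v))
    reach (suc j) with reach j
    ... | a , a∈ , col≡ = _ , successor-∈ a∈ , trans (cong (next (suc n)) col≡) (next-shiftCol (proj₂ v) j)

    column : ∀ t → Σ (Fin m) λ i → (i , t) ∈ L
    column t with shiftCol-onto (proj₂ v) t
    ... | j , refl with reach j
    ... | (i , _) , a∈ , refl = i , a∈

    -- the potential of the cycle is i₀ + d_{t₀} ≥ 0, read off at the column t₀ where h = 0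
    level : ℕ
    level = toℕ (proj₁ (column t₀)) + d t₀

    pot-v : pot v ≡ + level
    pot-v = trans (sym (pot-∈ (proj₂ (column t₀))))
      (trans (cong (λ z → + level Z.- + z) h-t₀) (ZP.+-identityʳ (+ level)))

    -- at the column before one with h = λ, the out-arc condition gives level + λ < m
    level+λ<m : level + λε < m
    level+λ<m with h-attains-λ
    ... | tλ , hλ with next-onto tλ
    ... | tp , refl with column tp
    ... | i , a∈ = subst (_< m) row+A≡ (proj₂ (hasOut-∈ a∈))
      where
      row+d≡ : toℕ i + d tp ≡ level + h tp
      row+d≡ = diff≡⇒≡+ (toℕ i + d tp) (h tp) level (trans (pot-∈ a∈) pot-v)
      row+A≡ : toℕ i + Aₜ tp ≡ level + λε
      row+A≡ = trans (+A≡+h-next (toℕ i) tp level row+d≡) (cong (λ z → level + z) hλ)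

    index : Fin K
    index = fromℕ< (NP.m+n≤o⇒m≤o∸n (suc level) level+λ<m)

    v≡w : v ≡ w index (proj₂ v)
    v≡w = pot⇒w (proj₁ v) (proj₂ v) index (trans pot-v (cong +_ (sym (FP.toℕ-fromℕ< _))))

  cycle⇒w : ∀ v → CycleComponent (suc n) m ε v → Σ (Fin K) λ k → v ≡ w k (proj₂ v)
  cycle⇒w v (L , _ , _ , iff , sameArcs) = index , v≡w
    where open InCycle v L iff sameArcs

  -- Ranks: rank(w_k(t)) = k·s + r_t, so the least vertex of every cycle lies in
  -- the column t_S minimising r.
  r : Fin (suc n) → ℕ
  r t = (h t ∸ d t) * suc n + toℕ t

  t_S : Fin (suc n)
  t_S = proj₁ (minimiser NP.≤-totalOrder r)

  r-min : ∀ t → r t_S ≤ r t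
  r-min = proj₂ (minimiser NP.≤-totalOrder r)

  rank-w : ∀ k t → rank (suc n) m ε (w k t) ≡ toℕ k * suc n + r t
  rank-w k t = trans (cong (λ z → z * suc n + toℕ t) (trans (FP.toℕ-fromℕ< (row< k t)) (NP.+-∸-assoc (toℕ k) (d≤h t))))
                     (regroup (toℕ k) (h t ∸ d t) (suc n) (toℕ t))
    where
    regroup : ∀ k x s t → (k + x) * s + t ≡ k * s + (x * s + t)
    regroup = solveℕ

  r-injective : ∀ t t′ → r t ≡ r t′ → t ≡ t′
  r-injective t t′ r≡ = FP.toℕ-injective (trans (sym (r%s t)) (trans (cong (_% suc n) r≡) (r%s t′)))
    where
    r%s : ∀ t → r t % suc n ≡ toℕ t
    r%s t = trans (cong (_% suc n) (NP.+-comm ((h t ∸ d t) * suc n) (toℕ t)))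
      (trans (DM.[m+kn]%n≡m%n (toℕ t) (h t ∸ d t) (suc n)) (DM.m<n⇒m%n≡m (FP.toℕ<n t)))

  representative-w : ∀ k → Representative (suc n) m ε (w k t_S)
  representative-w k (i , t) c = subst (λ y → rank (suc n) m ε (w k t_S) ≤ rank (suc n) m ε y) (sym x≡w)
      (subst₂ _≤_ (sym (rank-w k t_S)) (sym (rank-w k t)) (NP.+-monoʳ-≤ (toℕ k * suc n) (r-min t)))
    where
    x≡w : (i , t) ≡ w k t
    x≡w = pot⇒w i t k (trans (sym (pot-conn c)) (pot-w k t_S))

  representative⇒t_S : ∀ k t → Representative (suc n) m ε (w k t) → t ≡ t_S
  representative⇒t_S k t rep = r-injective t t_S (NP.≤-antisym rt≤ (r-min t))
    where
    rt≤ : r t ≤ r t_S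
    rt≤ = NP.+-cancelˡ-≤ (toℕ k * suc n) (r t) (r t_S)
            (subst₂ _≤_ (rank-w k t) (rank-w k t_S) (rep (w k t_S) (conn-w k t t_S)))

  representatives : List Vtx
  representatives = tabulate (λ k → w k t_S)

  representatives-unique : Unique representatives
  representatives-unique = tabulate⁺ λ {k} {k′} w≡ → FP.toℕ-injective (NP.+-cancelʳ-≡ (h t_S) (toℕ k) (toℕ k′)
    (trans (sym (w-row k t_S)) (trans (cong (λ q → toℕ (proj₁ q) + d t_S) w≡) (w-row k′ t_S))))

  representative-cycle : ∀ v → v ∈ representatives →
    Representative (suc n) m ε v × CycleComponent (suc n) m ε v
  representative-cycle v v∈ with ∈-tabulate⁻ {f = λ k → w k t_S} v∈
  ... | k , refl = representative-w k , cycle-w k t_S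

  cycle-representative : ∀ v → Representative (suc n) m ε v × CycleComponent (suc n) m ε v →
    v ∈ representatives
  cycle-representative v (rep , cyc) =
    subst (_∈ representatives) (sym (trans v≡w (cong (w k) t≡t_S))) (∈-tabulate⁺ k)
    where
    k : Fin K
    k = proj₁ (cycle⇒w v cyc)
    v≡w : v ≡ w k (proj₂ v)
    v≡w = proj₂ (cycle⇒w v cyc)
    t≡t_S : proj₂ v ≡ t_S
    t≡t_S = representative⇒t_S k (proj₂ v) (subst (Representative (suc n) m ε) v≡w rep)


theorem4p15 : (m : ℕ) → 1 ≤ m → (s : ℕ) .{{_ : NonZero s}} →
    (ε : Fin s → ℤ) → (λε : ℕ) →
    (∀ i → ε i ≡ + 1 ⊎ ε i ≡ + 0 ⊎ ε i ≡ - (+ 1)) →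
    IsCircularOfLevel s ε λε →
    NumCycleComponents s m ε (m ∸ λε)
theorem4p15 m _ (suc n) ε λε _ circ =
  representatives ,
  representatives-unique ,
  (λ v → mk⇔ (representative-cycle v) (cycle-representative v)) ,
  LP.length-tabulate (λ k → w k t_S)
  where open Components n m ε λε circ
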